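{- Let $f:\{0,1\}^n\to\{0,1\}$ with $f^{ -1}(1)\ne\emptyset$, let $0\le r\le n$ and $a\in\{0,1\}^n$, and let $h=f_{r,a}$. If $\mathrm{reldist}(f,h)\le0.05$, then for all $i\in[n]$, $$\Big|\Pr_{z\sim f^{ -1}(1)}[z_i=1]-\Pr_{z\sim h^{ -1}(1)}[z_i=1]\Big|\le0.05.$$
   Context: The truncation $f_{r,a}$ is defined by $f_{r,a}(x)=f(x)$ if the Hamming distance $\Delta(x,a)\le r$ and $f_{r,a}(x)=0$ otherwise. $\mathrm{reldist}(f,h)=|f^{ -1}(1)\triangle h^{ -1}(1)|/|f^{ -1}(1)|$. $z\sim S$ denotes a uniformly random element of the finite set $S$. -}

module Defs where

open import Data.Bool using (Bool; true; false; if_then_else_; _xor_)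
open import Data.Nat using (ℕ; zero; suc; _+_; _≤ᵇ_)
open import Data.Integer using (+_)
open import Data.Rational using (ℚ; 0ℚ; _/_)
open import Data.List using (List; []; _∷_; map; _++_)
open import Data.Vec using (Vec; []; _∷_)

cube : (n : ℕ) → List (Vec Bool n)
cube zero = [] ∷ []
cube (suc n) = map (true ∷_) (cube n) ++ map (false ∷_) (cube n)

count : {A : Set} → (A → Bool) → List A → ℕ
count p [] = 0
count p (x ∷ xs) = if p x then suc (count p xs) else count p xs

hamming : {n : ℕ} → Vec Bool n → Vec Bool n → ℕ
hamming [] [] = 0
hamming (x ∷ xs) (y ∷ ys) = (if x xor y then 1 else 0) + hamming xs ys

trunc : {n : ℕ} → (Vec Bool n → Bool) → ℕ → Vec Bool n → Vec Bool n → Bool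
trunc f r a x = if hamming x a ≤ᵇ r then f x else false

-- k / m as a rational; convention: value 0 when m = 0 (never used under
-- the hypotheses of the lemma, where all denominators are nonzero)
frac : ℕ → ℕ → ℚ
frac k zero = 0ℚ
frac k (suc m) = (+ k) / suc m

support : {n : ℕ} → (Vec Bool n → Bool) → ℕ
support {n} f = count f (cube n)

reldist : {n : ℕ} → (Vec Bool n → Bool) → (Vec Bool n → Bool) → ℚ
reldist {n} f h = frac (count (λ x → f x xor h x) (cube n)) (support f)

prob : {n : ℕ} → (Vec Bool n → Bool) → (Vec Bool n → Bool) → ℚ
prob {n} f p = frac (count (λ z → if f z then p z else false) (cube n)) (support f)

{-# OPTIONS --safe #-}
-- Let N = |f⁻¹(1)|, M = |h⁻¹(1)|, and let A, B be the numbers of points of f⁻¹(1), h⁻¹(1)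
-- with z_i = 1. As h⁻¹(1) ⊆ f⁻¹(1), we have N = M + d with d = |f⁻¹(1) △ h⁻¹(1)|, and
-- A = B + e with e ≤ d. Then A/N − B/M = (eM − Bd)/(NM) where both eM and Bd lie in [0, dM],
-- so the two frequencies differ by at most d/N = reldist(f, h).
module Submission where

open import Defs
open import Data.Bool using (Bool; true; false; if_then_else_; _xor_)
import Data.Bool as Bool
import Data.Bool.Properties as Bool
open import Data.Nat using (ℕ; zero; suc; _+_; _*_; _≤_; _≤ᵇ_; z≤n; s≤s; _⊔_)
import Data.Nat as ℕ
open import Data.Nat.Properties
  using (*-distribʳ-+; *-distribˡ-+; *-assoc; *-comm; +-suc; *-monoˡ-≤; ≤-trans; ≤-reflexive;
         m≤n⇒m≤1+n; ⊔-lub; ∣m-n∣≤m⊔n; ∣m+n-m+o∣≡∣n-o∣; ∣-∣-identityʳ; module ≤-Reasoning)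
open import Data.Integer as ℤ using (+_; _⊖_; +≤+)
import Data.Integer.Properties as ℤ
open import Data.Rational using (ℚ; _/_; _-_; -_; ∣_∣; toℚᵘ) renaming (_≤_ to _≤ℚ_)
import Data.Rational.Properties as ℚ
import Data.Rational.Unnormalised as ℚᵘ
open import Data.Rational.Unnormalised using (mkℚᵘ)
import Data.Rational.Unnormalised.Properties as ℚᵘ
open import Data.List using (List; []; _∷_)
open import Data.Vec using (Vec; lookup)
open import Data.Fin using (Fin)
open import Data.Product using (∃)
open import Relation.Binary.PropositionalEquality

-- Not `b ∧ c`: this is the form in which `trunc` and `prob` restrict a predicate, so it
-- matches them definitionally.
infixr 6 _⊓_

_⊓_ : Bool → Bool → Bool
b ⊓ c = if b then c else false

⊓-≤ˡ : ∀ b c → b ⊓ c Bool.≤ b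
⊓-≤ˡ false _     = Bool.b≤b
⊓-≤ˡ true  false = Bool.f≤t
⊓-≤ˡ true  true  = Bool.b≤b

⊓-≤ʳ : ∀ b c → b ⊓ c Bool.≤ c
⊓-≤ʳ false false = Bool.b≤b
⊓-≤ʳ false true  = Bool.f≤t
⊓-≤ʳ true  _     = Bool.b≤b

⊓-monoˡ-≤ : ∀ {b b′} c → b Bool.≤ b′ → b ⊓ c Bool.≤ b′ ⊓ c
⊓-monoˡ-≤ c Bool.b≤b = Bool.b≤b
⊓-monoˡ-≤ c Bool.f≤t = Bool.≤-minimum c

xor-⊓-≤ : ∀ b b′ c → (b ⊓ c) xor (b′ ⊓ c) Bool.≤ b xor b′
xor-⊓-≤ false false _     = Bool.b≤b
xor-⊓-≤ false true  c     = Bool.≤-maximum c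
xor-⊓-≤ true  false false = Bool.f≤t
xor-⊓-≤ true  false true  = Bool.b≤b
xor-⊓-≤ true  true  false = Bool.b≤b
xor-⊓-≤ true  true  true  = Bool.b≤b

module _ {X : Set} where

  count-mono : ∀ {p q : X → Bool} → (∀ x → p x Bool.≤ q x) → ∀ xs → count p xs ≤ count q xs
  count-mono p≤q [] = z≤n
  count-mono {p} {q} p≤q (x ∷ xs) with p x | q x | p≤q x
  ... | false | false | _ = count-mono p≤q xs
  ... | false | true  | _ = m≤n⇒m≤1+n (count-mono p≤q xs)
  ... | true  | true  | _ = s≤s (count-mono p≤q xs)

  count-xor : ∀ {p q : X → Bool} → (∀ x → q x Bool.≤ p x) → ∀ xs →
              count p xs ≡ count q xs + count (λ x → p x xor q x) xs
  count-xor q≤p [] = refl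
  count-xor {p} {q} q≤p (x ∷ xs) with p x | q x | q≤p x
  ... | false | false | _ = count-xor q≤p xs
  ... | true  | false | _ = trans (cong suc (count-xor q≤p xs)) (sym (+-suc _ _))
  ... | true  | true  | _ = cong suc (count-xor q≤p xs)

∣m⊖n∣≡∣m-n∣ : ∀ m n → ℤ.∣ m ⊖ n ∣ ≡ ℕ.∣ m - n ∣
∣m⊖n∣≡∣m-n∣ zero    zero    = refl
∣m⊖n∣≡∣m-n∣ zero    (suc n) = refl
∣m⊖n∣≡∣m-n∣ (suc m) zero    = refl
∣m⊖n∣≡∣m-n∣ (suc m) (suc n) =
  trans (cong ℤ.∣_∣ (ℤ.[1+m]⊖[1+n]≡m⊖n m n)) (∣m⊖n∣≡∣m-n∣ m n)

∣[m+n]*o-m*[o+p]∣≤p*o : ∀ {m n o p} → n ≤ p → m ≤ o →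
                        ℕ.∣ (m + n) * o - m * (o + p) ∣ ≤ p * o
∣[m+n]*o-m*[o+p]∣≤p*o {m} {n} {o} {p} n≤p m≤o = begin
  ℕ.∣ (m + n) * o - m * (o + p) ∣
    ≡⟨ cong₂ ℕ.∣_-_∣ (*-distribʳ-+ o m n) (*-distribˡ-+ m o p) ⟩
  ℕ.∣ m * o + n * o - m * o + m * p ∣ ≡⟨ ∣m+n-m+o∣≡∣n-o∣ (m * o) (n * o) (m * p) ⟩
  ℕ.∣ n * o - m * p ∣                 ≤⟨ ∣m-n∣≤m⊔n (n * o) (m * p) ⟩
  n * o ⊔ m * p                       ≤⟨ ⊔-lub (*-monoˡ-≤ o n≤p) m*p≤p*o ⟩
  p * o                               ∎
  where
  open ≤-Reasoning
  m*p≤p*o : m * p ≤ p * o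
  m*p≤p*o = ≤-trans (*-monoˡ-≤ p m≤o) (≤-reflexive (*-comm o p))

∣mkℚᵘ-mkℚᵘ∣≤mkℚᵘ : ∀ k l j m n → ℕ.∣ k * suc m - l * suc n ∣ ≤ j * suc m →
                    ℚᵘ.∣ mkℚᵘ (+ k) n ℚᵘ.- mkℚᵘ (+ l) m ∣ ℚᵘ.≤ mkℚᵘ (+ j) n
∣mkℚᵘ-mkℚᵘ∣≤mkℚᵘ k l j m n hyp = ℚᵘ.*≤* (begin
  + ℤ.∣ + k ℤ.* + suc m ℤ.+ ℤ.- (+ l) ℤ.* + suc n ∣ ℤ.* + suc n
    ≡⟨ cong (λ t → + t ℤ.* + suc n)
            (trans (cong ℤ.∣_∣ numerator) (∣m⊖n∣≡∣m-n∣ (k * suc m) (l * suc n))) ⟩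
  + ℕ.∣ k * suc m - l * suc n ∣ ℤ.* + suc n
    ≡⟨ ℤ.pos-* ℕ.∣ k * suc m - l * suc n ∣ (suc n) ⟨
  + (ℕ.∣ k * suc m - l * suc n ∣ * suc n)   ≤⟨ +≤+ (*-monoˡ-≤ (suc n) hyp) ⟩
  + (j * suc m * suc n)                     ≡⟨ cong +_ (*-assoc j (suc m) (suc n)) ⟩
  + (j * (suc m * suc n))                   ≡⟨ cong (λ t → + (j * t)) (*-comm (suc m) (suc n)) ⟩
  + (j * (suc n * suc m))                   ≡⟨ ℤ.pos-* j (suc n * suc m) ⟩
  + j ℤ.* + (suc n * suc m)                 ∎)
  where
  open ℤ.≤-Reasoning
  numerator : + k ℤ.* + suc m ℤ.+ ℤ.- (+ l) ℤ.* + suc n ≡ k * suc m ⊖ l * suc n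
  numerator = begin-equality
    + k ℤ.* + suc m ℤ.+ ℤ.- (+ l) ℤ.* + suc n
      ≡⟨ cong (λ t → + k ℤ.* + suc m ℤ.+ t) (ℤ.neg-distribˡ-* (+ l) (+ suc n)) ⟨
    + k ℤ.* + suc m ℤ.+ ℤ.- (+ l ℤ.* + suc n)
      ≡⟨ cong₂ (λ s t → s ℤ.+ ℤ.- t) (ℤ.pos-* k (suc m)) (ℤ.pos-* l (suc n)) ⟨
    + (k * suc m) ℤ.+ ℤ.- + (l * suc n)        ≡⟨ ℤ.m-n≡m⊖n (k * suc m) (l * suc n) ⟩
    k * suc m ⊖ l * suc n                      ∎

-- `_/_` on ℚ is, definitionally, `fromℚᵘ` of the unnormalised fraction.
toℚᵘ-frac : ∀ k n → toℚᵘ (frac k (suc n)) ℚᵘ.≃ mkℚᵘ (+ k) n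
toℚᵘ-frac k n = ℚ.toℚᵘ-fromℚᵘ (mkℚᵘ (+ k) n)

∣frac-frac∣≤frac : ∀ k l j m n → ℕ.∣ k * suc m - l * suc n ∣ ≤ j * suc m →
                   ∣ frac k (suc n) - frac l (suc m) ∣ ≤ℚ frac j (suc n)
∣frac-frac∣≤frac k l j m n hyp = ℚ.toℚᵘ-cancel-≤ (begin
  toℚᵘ ∣ P - Q ∣                        ≃⟨ ℚ.toℚᵘ-homo-∣-∣ (P - Q) ⟩
  ℚᵘ.∣ toℚᵘ (P - Q) ∣                   ≃⟨ ℚᵘ.∣-∣-cong (ℚ.toℚᵘ-homo-+ P (- Q)) ⟩
  ℚᵘ.∣ toℚᵘ P ℚᵘ.+ toℚᵘ (- Q) ∣         ≃⟨ ℚᵘ.∣-∣-cong (ℚᵘ.+-cong (toℚᵘ-frac k n) toℚᵘ-[-Q]) ⟩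
  ℚᵘ.∣ mkℚᵘ (+ k) n ℚᵘ.- mkℚᵘ (+ l) m ∣ ≤⟨ ∣mkℚᵘ-mkℚᵘ∣≤mkℚᵘ k l j m n hyp ⟩
  mkℚᵘ (+ j) n                          ≃⟨ toℚᵘ-frac j n ⟨
  toℚᵘ (frac j (suc n))                 ∎)
  where
  open ℚᵘ.≤-Reasoning
  P Q : ℚ
  P = frac k (suc n)
  Q = frac l (suc m)
  toℚᵘ-[-Q] : toℚᵘ (- Q) ℚᵘ.≃ ℚᵘ.- mkℚᵘ (+ l) m
  toℚᵘ-[-Q] = ℚᵘ.≃-trans (ℚ.toℚᵘ-homo‿- Q) (ℚᵘ.-‿cong (toℚᵘ-frac l m))

∣frac-frac∣≤frac-of-removal : ∀ {N M d A B e} → N ≡ M + d → A ≡ B + e → e ≤ d → B ≤ M →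
                              ∣ frac A N - frac B M ∣ ≤ℚ frac d N
∣frac-frac∣≤frac-of-removal {M = zero}  {zero}   refl refl _   _   = ℚ.≤-refl
∣frac-frac∣≤frac-of-removal {M = zero}  {suc d} {e = e} refl refl e≤d z≤n =
  -- B = 0 and frac 0 0 = frac 0 1 = 0ℚ, so the denominator M = 0 may be read as 1
  ∣frac-frac∣≤frac e 0 (suc d) 0 d
    (subst (_≤ suc d * 1) (sym (∣-∣-identityʳ (e * 1))) (*-monoˡ-≤ 1 e≤d))
∣frac-frac∣≤frac-of-removal {M = suc m} {d} {B = B} {e} refl refl e≤d B≤M =
  ∣frac-frac∣≤frac (B + e) B d m (m + d) (∣[m+n]*o-m*[o+p]∣≤p*o e≤d B≤M)

lemma3p10 : (n : ℕ) (f : Vec Bool n → Bool) → ∃ (λ x → f x ≡ true) →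
    (r : ℕ) → r ≤ n → (a : Vec Bool n) →
    reldist f (trunc f r a) ≤ℚ (+ 1 / 20) →
    (i : Fin n) →
    ∣ prob f (λ z → lookup z i) - prob (trunc f r a) (λ z → lookup z i) ∣ ≤ℚ (+ 1 / 20)
lemma3p10 n f _ r _ a reldist≤ i =
  ℚ.≤-trans (∣frac-frac∣≤frac-of-removal (count-xor h≤f xs) (count-xor h⊓p≤f⊓p xs)
                                          (count-mono xor-⊓p≤xor xs) (count-mono h⊓p≤h xs))
            reldist≤
  where
  xs : List (Vec Bool n)
  xs = cube n
  h : Vec Bool n → Bool
  h = trunc f r a
  p : Vec Bool n → Bool
  p z = lookup z i
  h≤f : ∀ x → h x Bool.≤ f x
  h≤f x = ⊓-≤ʳ (hamming x a ≤ᵇ r) (f x)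
  h⊓p≤f⊓p : ∀ x → h x ⊓ p x Bool.≤ f x ⊓ p x
  h⊓p≤f⊓p x = ⊓-monoˡ-≤ (p x) (h≤f x)
  h⊓p≤h : ∀ x → h x ⊓ p x Bool.≤ h x
  h⊓p≤h x = ⊓-≤ˡ (h x) (p x)
  xor-⊓p≤xor : ∀ x → (f x ⊓ p x) xor (h x ⊓ p x) Bool.≤ f x xor h x
  xor-⊓p≤xor x = xor-⊓-≤ (f x) (h x) (p x)
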